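{- Let $k>2$ be an integer and let $\mathcal{H}$ be a family of graphs such that either (P1) every $H\in\mathcal{H}$ contains a cycle of length at most $k$, or (P2) for every $H\in\mathcal{H}$ the complement $H^{\mathrm{c}}$ contains a cycle of length at most $k$. Then the class of $\mathcal{H}$-free graphs does not have the strong Erdős–Hajnal property.
   Context: All graphs are finite and simple; "contains a cycle" means as a (not necessarily induced) subgraph. A graph is $\mathcal{H}$-free if it has no induced subgraph isomorphic to a member of $\mathcal{H}$. A class $\mathcal{G}$ has the strong Erdős–Hajnal property if there exists $\delta>0$ such that every $G\in\mathcal{G}$ with at least two vertices has a homogeneous pair $(P,Q)$ with $|P|,|Q|\geq\delta|V(G)|$, where for disjoint $P,Q$, $(P,Q)$ is homogeneous if all edges between $P$ and $Q$ are present or none are. -}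

module Defs where

open import Data.Nat using (ℕ; zero; suc; _+_; _*_; _≤_; _<_)
open import Data.Bool using (Bool; true; false; not; _∧_)
open import Data.Fin using (Fin; zero; suc; inject₁; fromℕ)
open import Data.Fin.Properties using (_≟_)
open import Data.Fin.Subset using (Subset; _∈_; ∣_∣)
open import Data.Product using (Σ; _×_; _,_; ∃)
open import Data.Sum using (_⊎_)
open import Data.Empty using (⊥)
open import Relation.Nullary using (¬_; does)
open import Relation.Binary.PropositionalEquality using (_≡_)
open import Function.Definitions using (Injective)

record Graph : Set where
  field
    size  : ℕ
    adj   : Fin size → Fin size → Bool
    sym   : ∀ i j → adj i j ≡ adj j i
    irref : ∀ i → adj i i ≡ false
open Graph public

complement : Graph → Graph
complement G = record
  { size  = size G
  ; adj   = λ i j → not (adj G i j) ∧ not (does (i ≟ j))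
  ; sym   = symC
  ; irref = irrefC
  }
  where
  open import Relation.Binary.PropositionalEquality using (refl; sym; cong₂; cong)
  open import Relation.Nullary using (yes; no)
  symC : ∀ i j → (not (adj G i j) ∧ not (does (i ≟ j))) ≡ (not (adj G j i) ∧ not (does (j ≟ i)))
  symC i j with i ≟ j | j ≟ i
  ... | yes p | yes q = cong₂ _∧_ (cong not (Graph.sym G i j)) refl
  ... | yes refl | no q with q refl
  ... | ()
  symC i j | no p | yes refl with p refl
  ... | ()
  symC i j | no p | no q = cong₂ _∧_ (cong not (Graph.sym G i j)) refl
  irrefC : ∀ i → (not (adj G i i) ∧ not (does (i ≟ i))) ≡ false
  irrefC i with i ≟ i
  ... | yes _ = Data.Bool.Properties.∧-zeroʳ (not (adj G i i))
    where import Data.Bool.Properties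
  ... | no ¬p with ¬p refl
  ... | ()

HasCycleOfLength3+ : Graph → ℕ → Set
HasCycleOfLength3+ G m =
  Σ (Fin (3 + m) → Fin (size G)) λ c →
    Injective _≡_ _≡_ c
    × (∀ (i : Fin (2 + m)) → adj G (c (inject₁ i)) (c (suc i)) ≡ true)
    × adj G (c (fromℕ (2 + m))) (c zero) ≡ true

HasCycleAtMost : ℕ → Graph → Set
HasCycleAtMost k G = Σ ℕ λ m → (3 + m ≤ k) × HasCycleOfLength3+ G m

InducedSub : Graph → Graph → Set
InducedSub H G =
  Σ (Fin (size H) → Fin (size G)) λ f →
    Injective _≡_ _≡_ f × (∀ i j → adj H i j ≡ adj G (f i) (f j))

Family : Set₁
Family = Graph → Set

Free : Family → Graph → Set
Free ℋ G = ∀ H → ℋ H → ¬ InducedSub H G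

Homogeneous : (G : Graph) → Subset (size G) → Subset (size G) → Set
Homogeneous G P Q =
  (∀ v → v ∈ P → v ∈ Q → ⊥)
  × ((∀ p q → p ∈ P → q ∈ Q → adj G p q ≡ true)
     ⊎ (∀ p q → p ∈ P → q ∈ Q → adj G p q ≡ false))

-- The constant δ > 0 is
-- represented as 1/(suc m); since the condition is monotone in δ, the existence
-- of a real δ > 0 is equivalent to the existence of such an m.
-- |P| ≥ δ|V(G)| is written  size G ≤ suc m * ∣ P ∣.
StrongEH : (Graph → Set) → Set
StrongEH 𝒢 =
  Σ ℕ λ m → ∀ G → 𝒢 G → 2 ≤ size G →
    Σ (Subset (size G)) λ P → Σ (Subset (size G)) λ Q →
      Homogeneous G P Q × (size G ≤ suc m * ∣ P ∣) × (size G ≤ suc m * ∣ Q ∣)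

-- A random graph in which each pair is joined with probability about 2D/n (D a large constant) has,
-- in expectation, only a bounded number of cycles of length at most k + 2, while two disjoint sets
-- of s vertices span no edge between them with probability about (1 - D/n)^(s²), tiny compared with
-- the 4^n choices of the two sets once s is linear in n. So some outcome has no such pair of sets and
-- at most s short cycles. Isolating one vertex of each short cycle leaves a graph with no cycle of
-- length at most k + 2, hence containing no member of ℋ under (P1); an anticomplete pair with sides
-- of size 2s would keep s undeleted vertices on each side, and a complete pair with two vertices on
-- each side would contain a 4-cycle. So no homogeneous pair has sides of linear size; under (P2)
-- the complement of this graph is the witness.

module Submission where

open import Defs hiding (sym)

open import Data.Bool using (Bool; true; false; not; _∧_; _∨_; if_then_else_)
open import Data.Bool.ListAction using (any; or)
open import Data.Bool.Properties using (T-≡; ∨-comm; ∧-comm; ∧-identityʳ; not-involutive)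
  renaming (_≟_ to _≟ᵇ_)
open import Data.Empty using (⊥; ⊥-elim)
open import Data.Fin using (Fin; zero; suc; toℕ; lower₁; inject₁)
open import Data.Fin.Properties using (_≟_; all?)
import Data.Fin.Properties as Finₚ
open import Data.Fin.Subset using (Subset; ∣_∣)
open import Data.List using (List; []; _∷_; [_]; _++_; map; concatMap; length; allFin; upTo)
open import Data.List.Membership.Propositional using (_∈_; lose)
open import Data.List.Membership.Propositional.Properties using (∈-map⁺; ∈-concatMap⁺; ∈-upTo⁺; ∈-allFin)
open import Data.List.Properties using (map-tabulate; length-tabulate)
open import Data.List.Relation.Unary.Any using (here; there; satisfied)
open import Data.List.Relation.Unary.Any.Properties using (any⁺; any⁻)
open import Data.Nat hiding (_≟_)
open import Data.Nat.Properties hiding (_≟_)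
open import Data.Nat.Properties using () renaming (_≟_ to _≟ℕ_)
open import Algebra.Properties.CommutativeSemigroup +-commutativeSemigroup using ()
  renaming (interchange to +-interchange)
open import Data.Nat.Tactic.RingSolver using (solve-∀)
open import Data.Product using (∃; _×_; _,_; map₂; proj₁; proj₂)
open import Data.Sum using (_⊎_; inj₁; inj₂)
open import Data.Vec using (lookup) renaming (_∷_ to _∷ᵛ_; [] to []ᵛ)
open import Data.Vec.Functional using () renaming (_∷_ to _◂_)
open import Data.Vec.Properties using (lookup⇒[]=)
open import Function using (_∘_)
open import Function.Bundles using (Equivalence; mk⇔)
open import Relation.Binary.PropositionalEquality hiding ([_])
open import Relation.Nullary using (Dec; yes; no; does; ¬_; contradiction; _×-dec_; _→-dec_)
open import Relation.Nullary.Decidable using (does-⇔; dec-true; dec-false)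

private variable
  A B : Set

∧≡true⁻ : ∀ {a b} → a ∧ b ≡ true → a ≡ true × b ≡ true
∧≡true⁻ {true} {true} _ = refl , refl

∧≡false⇒ˡ : ∀ {a b} → a ∧ b ≡ false → b ≡ true → a ≡ false
∧≡false⇒ˡ {a} eq refl = trans (sym (∧-identityʳ a)) eq

∧≡false⇒ʳ : ∀ {a b} → a ∧ b ≡ false → a ≡ true → b ≡ false
∧≡false⇒ʳ eq refl = eq

∨≡false⇒ˡ : ∀ {a b} → a ∨ b ≡ false → a ≡ false
∨≡false⇒ˡ {false} _ = refl

not≡true⁻ : ∀ {a} → not a ≡ true → a ≡ false
not≡true⁻ {false} _ = refl

does-false⁻ : ∀ {P : Set} (p? : Dec P) → does p? ≡ false → ¬ P
does-false⁻ (no ¬p) _ = ¬p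

any-true⁺ : (p : A → Bool) {xs : List A} {x : A} → x ∈ xs → p x ≡ true → any p xs ≡ true
any-true⁺ p x∈xs px = Equivalence.to T-≡ (any⁺ p (lose x∈xs (Equivalence.from T-≡ px)))

any-true⁻ : (p : A → Bool) (xs : List A) → any p xs ≡ true → ∃ λ x → p x ≡ true
any-true⁻ p xs eq = map₂ (Equivalence.to T-≡) (satisfied (any⁻ p xs (Equivalence.from T-≡ eq)))

𝟙 : Bool → ℕ
𝟙 true  = 1
𝟙 false = 0

∑ : List A → (A → ℕ) → ℕ
∑ []       f = 0
∑ (x ∷ xs) f = f x + ∑ xs f

syntax ∑ xs (λ x → e) = ∑[ x ← xs ] e

∑-cong : (xs : List A) {f g : A → ℕ} → (∀ x → f x ≡ g x) → ∑ xs f ≡ ∑ xs g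
∑-cong []       f≗g = refl
∑-cong (x ∷ xs) f≗g = cong₂ _+_ (f≗g x) (∑-cong xs f≗g)

∑-mono : (xs : List A) {f g : A → ℕ} → (∀ x → f x ≤ g x) → ∑ xs f ≤ ∑ xs g
∑-mono []       f≤g = z≤n
∑-mono (x ∷ xs) f≤g = +-mono-≤ (f≤g x) (∑-mono xs f≤g)

∑-distrib-+ : (xs : List A) (f g : A → ℕ) → ∑[ x ← xs ] (f x + g x) ≡ ∑ xs f + ∑ xs g
∑-distrib-+ []       f g = refl
∑-distrib-+ (x ∷ xs) f g =
  trans (cong (f x + g x +_) (∑-distrib-+ xs f g)) (+-interchange (f x) (g x) _ _)

*-distribˡ-∑ : (c : ℕ) (xs : List A) (f : A → ℕ) → c * ∑ xs f ≡ ∑[ x ← xs ] (c * f x)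
*-distribˡ-∑ c []       f = *-zeroʳ c
*-distribˡ-∑ c (x ∷ xs) f = trans (*-distribˡ-+ c (f x) _) (cong (c * f x +_) (*-distribˡ-∑ c xs f))

*-distribʳ-∑ : (c : ℕ) (xs : List A) (f : A → ℕ) → ∑ xs f * c ≡ ∑[ x ← xs ] (f x * c)
*-distribʳ-∑ c xs f = trans (*-comm _ c) (trans (*-distribˡ-∑ c xs f) (∑-cong xs λ x → *-comm c (f x)))

∑-++ : (xs ys : List A) (f : A → ℕ) → ∑ (xs ++ ys) f ≡ ∑ xs f + ∑ ys f
∑-++ []       ys f = refl
∑-++ (x ∷ xs) ys f = trans (cong (f x +_) (∑-++ xs ys f)) (sym (+-assoc (f x) _ _))

∑-map : (g : A → B) (xs : List A) (f : B → ℕ) → ∑ (map g xs) f ≡ ∑ xs (f ∘ g)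
∑-map g []       f = refl
∑-map g (x ∷ xs) f = cong (f (g x) +_) (∑-map g xs f)

∑-concatMap : (g : A → List B) (xs : List A) (f : B → ℕ) →
              ∑ (concatMap g xs) f ≡ ∑[ x ← xs ] ∑ (g x) f
∑-concatMap g []       f = refl
∑-concatMap g (x ∷ xs) f = trans (∑-++ (g x) _ f) (cong (∑ (g x) f +_) (∑-concatMap g xs f))

∑-const : (xs : List A) (c : ℕ) → ∑[ x ← xs ] c ≡ length xs * c
∑-const []       c = refl
∑-const (x ∷ xs) c = cong (c +_) (∑-const xs c)

∑-zero : (xs : List A) → ∑[ x ← xs ] 0 ≡ 0
∑-zero xs = trans (∑-const xs 0) (*-zeroʳ (length xs))

∑-comm : (xs : List A) (ys : List B) (f : A → B → ℕ) →
         ∑[ x ← xs ] ∑[ y ← ys ] f x y ≡ ∑[ y ← ys ] ∑[ x ← xs ] f x y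
∑-comm []       ys f = sym (∑-zero ys)
∑-comm (x ∷ xs) ys f =
  trans (cong (∑ ys (f x) +_) (∑-comm xs ys f)) (sym (∑-distrib-+ ys (f x) _))

∑≤length* : (xs : List A) {f : A → ℕ} {b : ℕ} → (∀ x → f x ≤ b) → ∑ xs f ≤ length xs * b
∑≤length* xs {b = b} f≤b = ≤-trans (∑-mono xs f≤b) (≤-reflexive (∑-const xs b))

∑-averaging : (xs : List A) (f : A → ℕ) {m b : ℕ} .{{_ : NonZero m}} →
              length xs ≡ m → (∀ x → f x * m ≤ b) → ∑ xs f ≤ b
∑-averaging xs f {m} {b} ∣xs∣≡m f*m≤b = *-cancelʳ-≤ _ _ m (begin
  ∑ xs f * m            ≡⟨ *-distribʳ-∑ m xs f ⟩
  ∑[ x ← xs ] (f x * m) ≤⟨ ∑≤length* xs f*m≤b ⟩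
  length xs * b         ≡⟨ trans (cong (_* b) ∣xs∣≡m) (*-comm m b) ⟩
  b * m                 ∎)
  where open ≤-Reasoning

∈⇒≤∑ : {xs : List A} {x : A} (f : A → ℕ) → x ∈ xs → f x ≤ ∑ xs f
∈⇒≤∑ f (here refl) = m≤m+n _ _
∈⇒≤∑ f (there x∈xs) = ≤-trans (∈⇒≤∑ f x∈xs) (m≤n+m _ _)

∑<length*⇒∃< : (xs : List A) (f : A → ℕ) (c : ℕ) → ∑ xs f < length xs * c →
               ∃ λ x → x ∈ xs × f x < c
∑<length*⇒∃< (x ∷ xs) f c ∑<
  with f x <? c
... | yes fx<c = x , here refl , fx<c
... | no  fx≮c with ∑<length*⇒∃< xs f c (+-cancelˡ-< c _ _ (≤-<-trans (+-monoˡ-≤ _ (≮⇒≥ fx≮c)) ∑<))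
...   | y , y∈xs , fy<c = y , there y∈xs , fy<c

𝟙-any≤∑ : (p : A → Bool) (xs : List A) → 𝟙 (any p xs) ≤ ∑[ x ← xs ] 𝟙 (p x)
𝟙-any≤∑ p []       = z≤n
𝟙-any≤∑ p (x ∷ xs) with p x
... | true  = s≤s z≤n
... | false = 𝟙-any≤∑ p xs

-- The average of (s + 1) · a + w is below s + 1, so some x has a x = 0 and w x ≤ s.
first-moment : (xs : List A) (a w : A → ℕ) {s K : ℕ} → 0 < length xs →
  2 * ∑ xs a ≤ length xs → ∑ xs w ≤ K * length xs → 2 * K ≤ s →
  ∃ λ x → a x ≡ 0 × w x ≤ s
first-moment xs a w {s} {K} 0<T 2A≤T W≤KT 2K≤s
  with ∑<length*⇒∃< xs (λ x → suc s * a x + w x) (suc s) (*-cancelˡ-< 2 _ _ (begin-strict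
    2 * ∑[ x ← xs ] (suc s * a x + w x)       ≡⟨ cong (2 *_) (trans (∑-distrib-+ xs _ w) (cong (_+ ∑ xs w) (sym (*-distribˡ-∑ (suc s) xs a)))) ⟩
    2 * (suc s * ∑ xs a + ∑ xs w)             ≡⟨ reassoc (suc s) (∑ xs a) (∑ xs w) ⟩
    suc s * (2 * ∑ xs a) + 2 * ∑ xs w         ≤⟨ +-mono-≤ (*-monoʳ-≤ (suc s) 2A≤T) (*-monoʳ-≤ 2 W≤KT) ⟩
    suc s * T + 2 * (K * T)                   ≡⟨ cong (suc s * T +_) (*-assoc 2 K T) ⟨
    suc s * T + 2 * K * T                     ≤⟨ +-monoʳ-≤ (suc s * T) (*-monoˡ-≤ T 2K≤s) ⟩
    suc s * T + s * T                         <⟨ +-monoʳ-< (suc s * T) (*-monoˡ-< T {{>-nonZero 0<T}} (n<1+n s)) ⟩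
    suc s * T + suc s * T                     ≡⟨ cong (suc s * T +_) (+-identityʳ _) ⟨
    2 * (suc s * T)                           ≡⟨ cong (2 *_) (*-comm (suc s) T) ⟩
    2 * (T * suc s)                           ∎))
  where
  open ≤-Reasoning
  T = length xs
  reassoc : ∀ x y z → 2 * (x * y + z) ≡ x * (2 * y) + 2 * z
  reassoc = solve-∀
... | x , _ , lt = x , n<1⇒n≡0 (*-cancelˡ-< (suc s) _ 1 (≤-trans (s≤s (m≤m+n _ (w x))) (≤-trans lt (≤-reflexive (sym (*-identityʳ _)))))) ,
                   ≤-pred (≤-trans (s≤s (m≤n+m (w x) _)) lt)

length-allFin : ∀ n → length (allFin n) ≡ n
length-allFin n = length-tabulate (λ i → i)

∑-allFin-suc : ∀ n (f : Fin (suc n) → ℕ) → ∑ (allFin (suc n)) f ≡ f zero + ∑[ i ← allFin n ] f (suc i)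
∑-allFin-suc n f = cong (f zero +_) (trans (cong (λ is → ∑ is f) (sym (map-tabulate (λ i → i) suc)))
                                           (∑-map suc (allFin n) f))

∏ : (n : ℕ) → (Fin n → ℕ) → ℕ
∏ zero    f = 1
∏ (suc n) f = f zero * ∏ n (f ∘ suc)

∏-cong : ∀ n {f g : Fin n → ℕ} → (∀ i → f i ≡ g i) → ∏ n f ≡ ∏ n g
∏-cong zero    f≗g = refl
∏-cong (suc n) f≗g = cong₂ _*_ (f≗g zero) (∏-cong n (f≗g ∘ suc))

∏-distrib-* : ∀ n (f g : Fin n → ℕ) → ∏ n (λ i → f i * g i) ≡ ∏ n f * ∏ n g
∏-distrib-* zero    f g = refl
∏-distrib-* (suc n) f g = trans (cong (f zero * g zero *_) (∏-distrib-* n (f ∘ suc) (g ∘ suc)))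
                                ([m*n]*[o*p]≡[m*o]*[n*p] (f zero) (g zero) _ _)

∏-const : ∀ n c → ∏ n (λ _ → c) ≡ c ^ n
∏-const zero    c = refl
∏-const (suc n) c = cong (c *_) (∏-const n c)

∏-^ : ∀ n c (f : Fin n → ℕ) → ∏ n (λ i → c ^ f i) ≡ c ^ ∑ (allFin n) f
∏-^ zero    c f = refl
∏-^ (suc n) c f = begin
  c ^ f zero * ∏ n (λ i → c ^ f (suc i))  ≡⟨ cong (c ^ f zero *_) (∏-^ n c (f ∘ suc)) ⟩
  c ^ f zero * c ^ ∑ (allFin n) (f ∘ suc) ≡⟨ ^-distribˡ-+-* c (f zero) _ ⟨
  c ^ (f zero + ∑ (allFin n) (f ∘ suc))   ≡⟨ cong (c ^_) (∑-allFin-suc n f) ⟨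
  c ^ ∑ (allFin (suc n)) f                ∎
  where open ≡-Reasoning

1≤∏ : ∀ n {f : Fin n → ℕ} → (∀ i → 1 ≤ f i) → 1 ≤ ∏ n f
1≤∏ zero    1≤f = s≤s z≤n
1≤∏ (suc n) 1≤f = *-mono-≤ (1≤f zero) (1≤∏ n (1≤f ∘ suc))

∏-𝟙-true : ∀ n (b : Fin n → Bool) → (∀ i → b i ≡ true) → ∏ n (𝟙 ∘ b) ≡ 1
∏-𝟙-true zero    b _   = refl
∏-𝟙-true (suc n) b all rewrite all zero = trans (+-identityʳ _) (∏-𝟙-true n (b ∘ suc) (all ∘ suc))

∏-𝟙≤ : ∀ n (b : Fin n → Bool) {x : ℕ} → ((∀ i → b i ≡ true) → 1 ≤ x) → ∏ n (𝟙 ∘ b) ≤ x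
∏-𝟙≤ zero    b ≤x = ≤x (λ ())
∏-𝟙≤ (suc n) b ≤x with b zero in b₀
... | false = z≤n
... | true  = subst (_≤ _) (sym (+-identityʳ _))
                (∏-𝟙≤ n (b ∘ suc) λ all → ≤x λ { zero → b₀ ; (suc i) → all i })

^-distribʳ-* : ∀ a b e → (a * b) ^ e ≡ a ^ e * b ^ e
^-distribʳ-* a b e = trans (sym (∏-const e (a * b)))
                           (trans (∏-distrib-* e _ _) (cong₂ _*_ (∏-const e a) (∏-const e b)))

ratio-pow-≤ : ∀ {a b t} n e x .{{_ : NonZero n}} → b ≤ n →
              a * n ^ (e + x) ≡ b ^ (e + x) * t → a * n ^ e ≤ b ^ e * t
ratio-pow-≤ {a} {b} {t} n e x b≤n eq = *-cancelʳ-≤ _ _ (n ^ x) {{m^n≢0 n x}} (begin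
  a * n ^ e * n ^ x   ≡⟨ trans (cong (a *_) (^-distribˡ-+-* n e x)) (sym (*-assoc a _ _)) ⟨
  a * n ^ (e + x)     ≡⟨ eq ⟩
  b ^ (e + x) * t     ≡⟨ cong (_* t) (^-distribˡ-+-* b e x) ⟩
  b ^ e * b ^ x * t   ≤⟨ *-monoˡ-≤ t (*-monoʳ-≤ (b ^ e) (^-monoˡ-≤ x b≤n)) ⟩
  b ^ e * n ^ x * t   ≡⟨ trans (*-assoc (b ^ e) _ _) (trans (cong (b ^ e *_) (*-comm (n ^ x) t)) (sym (*-assoc (b ^ e) t _))) ⟩
  b ^ e * t * n ^ x   ∎)
  where open ≤-Reasoning

functions : (k : ℕ) → List A → List (Fin k → A)
functions zero    xs = [ (λ ()) ]
functions (suc k) xs = concatMap (λ a → map (a ◂_) (functions k xs)) xs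

∑-functions-∏ : ∀ k (xs : List A) (φ : Fin k → A → ℕ) →
                ∑[ f ← functions k xs ] ∏ k (λ i → φ i (f i)) ≡ ∏ k (λ i → ∑ xs (φ i))
∑-functions-∏ zero    xs φ = refl
∑-functions-∏ (suc k) xs φ = begin
  ∑ (concatMap (λ a → map (a ◂_) fs) xs) h          ≡⟨ ∑-concatMap _ xs h ⟩
  ∑[ a ← xs ] ∑ (map (a ◂_) fs) h                   ≡⟨ ∑-cong xs (λ a → ∑-map (a ◂_) fs h) ⟩
  ∑[ a ← xs ] ∑[ f ← fs ] (φ zero a * rest f)       ≡⟨ ∑-cong xs (λ a → *-distribˡ-∑ (φ zero a) fs rest) ⟨
  ∑[ a ← xs ] (φ zero a * ∑ fs rest)                ≡⟨ ∑-cong xs (λ a → cong (φ zero a *_) (∑-functions-∏ k xs (φ ∘ suc))) ⟩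
  ∑[ a ← xs ] (φ zero a * ∏ k (λ i → ∑ xs (φ (suc i)))) ≡⟨ *-distribʳ-∑ _ xs (φ zero) ⟨
  ∑ xs (φ zero) * ∏ k (λ i → ∑ xs (φ (suc i)))      ∎
  where
  open ≡-Reasoning
  fs = functions k xs
  h : (Fin (suc k) → _) → ℕ
  h f = ∏ (suc k) (λ i → φ i (f i))
  rest : (Fin k → _) → ℕ
  rest f = ∏ k (λ i → φ (suc i) (f i))

length-functions : ∀ k (xs : List A) → length (functions k xs) ≡ length xs ^ k
length-functions k xs = begin
  length (functions k xs)                     ≡⟨ length≡∑1 (functions k xs) ⟩
  ∑[ f ← functions k xs ] 1                   ≡⟨ ∑-cong (functions k xs) (λ _ → ∏1≡1) ⟨
  ∑[ f ← functions k xs ] ∏ k (λ _ → 1)       ≡⟨ ∑-functions-∏ k xs (λ _ _ → 1) ⟩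
  ∏ k (λ _ → ∑[ x ← xs ] 1)                   ≡⟨ ∏-cong k (λ _ → length≡∑1 xs) ⟨
  ∏ k (λ _ → length xs)                       ≡⟨ ∏-const k (length xs) ⟩
  length xs ^ k                               ∎
  where
  open ≡-Reasoning
  length≡∑1 : (ys : List B) → length ys ≡ ∑[ y ← ys ] 1
  length≡∑1 ys = sym (trans (∑-const ys 1) (*-identityʳ (length ys)))
  ∏1≡1 : ∏ k (λ _ → 1) ≡ 1
  ∏1≡1 = trans (∏-const k 1) (^-zeroˡ k)

functions-complete : ∀ k {xs : List A} → (∀ a → a ∈ xs) → (f : Fin k → A) →
                     ∃ λ g → g ∈ functions k xs × (∀ i → g i ≡ f i)
functions-complete zero    _     f = (λ ()) , here refl , λ ()
functions-complete (suc k) {xs} every f with functions-complete k every (f ∘ suc)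
... | g , g∈ , g≗f = f zero ◂ g , ∈-concatMap⁺ _ (lose (every (f zero)) (∈-map⁺ (f zero ◂_) g∈)) ,
                     λ { zero → refl ; (suc i) → g≗f i }

count : ∀ {n} → (Fin n → Bool) → ℕ
count {n} p = ∑[ i ← allFin n ] 𝟙 (p i)

count₂ : ∀ {n} → (Fin n → Fin n → Bool) → ℕ
count₂ {n} φ = ∑[ u ← allFin n ] count (φ u)

count-suc : ∀ {n} (p : Fin (suc n) → Bool) → count p ≡ 𝟙 (p zero) + count (p ∘ suc)
count-suc {n} p = ∑-allFin-suc n (𝟙 ∘ p)

count-false : ∀ n → count {n} (λ _ → false) ≡ 0
count-false n = ∑-zero (allFin n)

count-≡ : ∀ {n} (x : Fin n) → count (λ u → does (u ≟ x)) ≡ 1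
count-≡ {suc n} zero    = trans (count-suc {n} (λ u → does (u ≟ zero))) (cong suc (count-false n))
count-≡ {suc n} (suc x) = trans (count-suc {n} (λ u → does (u ≟ suc x))) (count-≡ x)

count-<ᵇ : ∀ n D → count {n} (λ i → toℕ i <ᵇ D) ≡ n ⊓ D
count-<ᵇ zero    D       = refl
count-<ᵇ (suc n) zero    = trans (count-suc {n} (λ i → toℕ i <ᵇ 0)) (count-false n)
count-<ᵇ (suc n) (suc D) = trans (count-suc {n} (λ i → toℕ i <ᵇ suc D)) (cong suc (count-<ᵇ n D))

count+count-not : ∀ {n} (p : Fin n → Bool) → count p + count (not ∘ p) ≡ n
count+count-not {zero}  p = refl
count+count-not {suc n} p = begin
  count p + count (not ∘ p)                                       ≡⟨ cong₂ _+_ (count-suc p) (count-suc (not ∘ p)) ⟩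
  𝟙 (p zero) + count (p ∘ suc) + (𝟙 (not (p zero)) + count (not ∘ p ∘ suc)) ≡⟨ +-interchange (𝟙 (p zero)) _ _ _ ⟩
  𝟙 (p zero) + 𝟙 (not (p zero)) + (count (p ∘ suc) + count (not ∘ p ∘ suc)) ≡⟨ cong₂ _+_ (𝟙b+𝟙¬b≡1 (p zero)) (count+count-not (p ∘ suc)) ⟩
  suc n                                                           ∎
  where
  open ≡-Reasoning
  𝟙b+𝟙¬b≡1 : ∀ b → 𝟙 b + 𝟙 (not b) ≡ 1
  𝟙b+𝟙¬b≡1 true  = refl
  𝟙b+𝟙¬b≡1 false = refl

count≤n : ∀ {n} (p : Fin n → Bool) → count p ≤ n
count≤n p = subst (count p ≤_) (count+count-not p) (m≤m+n _ _)

𝟙-∧ : ∀ a b → 𝟙 (a ∧ b) ≡ 𝟙 a * 𝟙 b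
𝟙-∧ true  b = sym (+-identityʳ (𝟙 b))
𝟙-∧ false b = refl

count-∧ˡ : ∀ {n} b (p : Fin n → Bool) → count (λ u → b ∧ p u) ≡ 𝟙 b * count p
count-∧ˡ {n} b p = trans (∑-cong (allFin n) (λ u → 𝟙-∧ b (p u))) (sym (*-distribˡ-∑ (𝟙 b) (allFin n) (𝟙 ∘ p)))

count₂-∧ : ∀ {n} (p q : Fin n → Bool) → count₂ (λ u v → p u ∧ q v) ≡ count p * count q
count₂-∧ {n} p q = trans (∑-cong (allFin n) (λ u → count-∧ˡ (p u) q))
                         (sym (*-distribʳ-∑ (count q) (allFin n) (𝟙 ∘ p)))

∣p∣≡count : ∀ {n} (P : Subset n) → ∣ P ∣ ≡ count (lookup P)
∣p∣≡count []ᵛ          = refl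
∣p∣≡count (true  ∷ᵛ P) = trans (cong suc (∣p∣≡count P)) (sym (count-suc (lookup (true ∷ᵛ P))))
∣p∣≡count (false ∷ᵛ P) = trans (∣p∣≡count P) (sym (count-suc (lookup (false ∷ᵛ P))))

0<count⇒∃ : ∀ {n} (p : Fin n → Bool) → 0 < count p → ∃ λ x → p x ≡ true
0<count⇒∃ {suc n} p 0<c with p zero in p₀ | subst (0 <_) (count-suc p) 0<c
... | true  | _      = zero , p₀
... | false | 0<rest with 0<count⇒∃ (p ∘ suc) 0<rest
...   | x , px = suc x , px

count≤count-∧-not+count : ∀ {n} (p r : Fin n → Bool) → count p ≤ count (λ u → p u ∧ not (r u)) + count r
count≤count-∧-not+count {n} p r =
  ≤-trans (∑-mono (allFin n) split) (≤-reflexive (∑-distrib-+ (allFin n) _ _))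
  where
  split : ∀ u → 𝟙 (p u) ≤ 𝟙 (p u ∧ not (r u)) + 𝟙 (r u)
  split u with p u | r u
  ... | true  | true  = s≤s z≤n
  ... | true  | false = s≤s z≤n
  ... | false | _     = z≤n

1<count⇒∃₂ : ∀ {n} (p : Fin n → Bool) → 1 < count p →
             ∃ λ x → ∃ λ y → p x ≡ true × p y ≡ true × x ≢ y
1<count⇒∃₂ p 1<c =
  let x , px       = 0<count⇒∃ p (<-trans (s≤s z≤n) 1<c)
      y , py∧y≢x   = 0<count⇒∃ (others x) (≤-pred (≤-trans 1<c (count≤suc-count-others x)))
      py , ¬y≟x    = ∧≡true⁻ py∧y≢x
  in  x , y , px , py , λ x≡y → does-false⁻ (y ≟ x) (not≡true⁻ ¬y≟x) (sym x≡y)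
  where
  others : Fin _ → Fin _ → Bool
  others x u = p u ∧ not (does (u ≟ x))
  count≤suc-count-others : ∀ x → count p ≤ suc (count (others x))
  count≤suc-count-others x = subst (count p ≤_) (trans (cong (count (others x) +_) (count-≡ x)) (+-comm _ 1))
                                   (count≤count-∧-not+count p (λ u → does (u ≟ x)))

⁅_⁆₂ : ∀ {n} → Fin n × Fin n → Fin n → Fin n → Bool
⁅ x , y ⁆₂ u v = does (u ≟ x) ∧ does (v ≟ y)

⁅⁆₂-true⁻ : ∀ {n} {u v : Fin n} p → ⁅ p ⁆₂ u v ≡ true → (u , v) ≡ p
⁅⁆₂-true⁻ {u = u} {v} (x , y) eq with u ≟ x | v ≟ y | eq
... | yes refl | yes refl | _ = refl

image : ∀ {n L} → (Fin L → Fin n × Fin n) → Fin n → Fin n → Bool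
image {L = L} κ u v = any (λ a → ⁅ κ a ⁆₂ u v) (allFin L)

image-suc : ∀ {n L} (κ : Fin (suc L) → Fin n × Fin n) u v →
            image κ u v ≡ ⁅ κ zero ⁆₂ u v ∨ image (κ ∘ suc) u v
image-suc κ u v = cong (λ bs → ⁅ κ zero ⁆₂ u v ∨ or bs)
  (trans (map-tabulate suc p) (sym (map-tabulate (λ i → i) (p ∘ suc))))
  where
  p = λ a → ⁅ κ a ⁆₂ u v

count₂-image : ∀ {n L} (κ : Fin L → Fin n × Fin n) → (∀ {a b} → κ a ≡ κ b → a ≡ b) →
               count₂ (image κ) ≡ L
count₂-image {n} {zero} κ _ = trans (∑-cong (allFin n) (λ _ → count-false n)) (count-false n)
count₂-image {n} {suc L} κ κ-inj = begin
  count₂ (image κ)                                            ≡⟨ ∑-cong (allFin n) (λ u → ∑-cong (allFin n) (λ v → split u v)) ⟩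
  ∑[ u ← allFin n ] ∑[ v ← allFin n ] (𝟙 (⁅ κ zero ⁆₂ u v) + 𝟙 (image (κ ∘ suc) u v))
                                                              ≡⟨ ∑-cong (allFin n) (λ u → ∑-distrib-+ (allFin n) _ _) ⟩
  ∑[ u ← allFin n ] (count (⁅ κ zero ⁆₂ u) + count (image (κ ∘ suc) u))
                                                              ≡⟨ ∑-distrib-+ (allFin n) _ _ ⟩
  count₂ ⁅ κ zero ⁆₂ + count₂ (image (κ ∘ suc))              ≡⟨ cong₂ _+_ (count₂-⁅⁆₂ (κ zero)) (count₂-image (κ ∘ suc) (Finₚ.suc-injective ∘ κ-inj)) ⟩
  suc L                                                       ∎
  where
  open ≡-Reasoning
  count₂-⁅⁆₂ : ∀ p → count₂ ⁅ p ⁆₂ ≡ 1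
  count₂-⁅⁆₂ (x , y) = trans (count₂-∧ (λ u → does (u ≟ x)) (λ v → does (v ≟ y)))
                             (cong₂ _*_ (count-≡ x) (count-≡ y))
  𝟙-∨ : ∀ a b → (a ≡ true → b ≡ true → ⊥) → 𝟙 (a ∨ b) ≡ 𝟙 a + 𝟙 b
  𝟙-∨ true  true  both = ⊥-elim (both refl refl)
  𝟙-∨ true  false _    = refl
  𝟙-∨ false b     _    = refl
  split : ∀ u v → 𝟙 (image κ u v) ≡ 𝟙 (⁅ κ zero ⁆₂ u v) + 𝟙 (image (κ ∘ suc) u v)
  split u v = trans (cong 𝟙 (image-suc κ u v)) (𝟙-∨ _ _ λ at₀ at-suc →
    let a , atₐ = any-true⁻ (λ a → ⁅ κ (suc a) ⁆₂ u v) (allFin L) at-suc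
    in  Finₚ.0≢1+n (κ-inj (trans (sym (⁅⁆₂-true⁻ {u = u} {v} (κ zero) at₀)) (⁅⁆₂-true⁻ {u = u} {v} (κ (suc a)) atₐ))))

-- Random digraphs

-- Probabilities are counts over all seeds: for a uniformly random seed F the entries F u v are
-- independent and uniform on Fin n.

Seed : ℕ → Set
Seed n = Fin n → Fin n → Fin n

seeds : (n : ℕ) → List (Seed n)
seeds n = functions n (functions n (allFin n))

∏∏ : ∀ n → (Fin n → Fin n → ℕ) → ℕ
∏∏ n f = ∏ n (λ u → ∏ n (f u))

length-seeds : ∀ n → length (seeds n) ≡ (n ^ n) ^ n
length-seeds n = trans (length-functions n _)
  (cong (_^ n) (trans (length-functions n (allFin n)) (cong (_^ n) (length-allFin n))))

∑-seeds-∏∏ : ∀ n (ψ : Fin n → Fin n → Fin n → ℕ) →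
  ∑[ F ← seeds n ] ∏∏ n (λ u v → ψ u v (F u v)) ≡ ∏∏ n (λ u v → ∑ (allFin n) (ψ u v))
∑-seeds-∏∏ n ψ = trans (∑-functions-∏ n _ (λ u r → ∏ n (λ v → ψ u v (r v))))
                       (∏-cong n (λ u → ∑-functions-∏ n (allFin n) (ψ u)))

∏-if : ∀ n (φ : Fin n → Bool) a b → ∏ n (λ i → if φ i then a else b) * b ^ count φ ≡ a ^ count φ * b ^ n
∏-if n φ a b = begin
  ∏ n (λ i → if φ i then a else b) * b ^ count φ              ≡⟨ cong (∏ n _ *_) (∏-^ n b (𝟙 ∘ φ)) ⟨
  ∏ n (λ i → if φ i then a else b) * ∏ n (λ i → b ^ 𝟙 (φ i))  ≡⟨ ∏-distrib-* n _ _ ⟨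
  ∏ n (λ i → (if φ i then a else b) * b ^ 𝟙 (φ i))            ≡⟨ ∏-cong n (λ i → pointwise (φ i)) ⟩
  ∏ n (λ i → a ^ 𝟙 (φ i) * b)                                 ≡⟨ ∏-distrib-* n _ _ ⟩
  ∏ n (λ i → a ^ 𝟙 (φ i)) * ∏ n (λ _ → b)                     ≡⟨ cong₂ _*_ (∏-^ n a (𝟙 ∘ φ)) (∏-const n b) ⟩
  a ^ count φ * b ^ n                                         ∎
  where
  open ≡-Reasoning
  pointwise : ∀ c → (if c then a else b) * b ^ 𝟙 c ≡ a ^ 𝟙 c * b
  pointwise true  = trans (cong (a *_) (*-identityʳ b)) (cong (_* b) (sym (*-identityʳ a)))
  pointwise false = trans (*-identityʳ b) (sym (+-identityʳ b))

∏∏-if : ∀ n (φ : Fin n → Fin n → Bool) a b →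
        ∏∏ n (λ u v → if φ u v then a else b) * b ^ count₂ φ ≡ a ^ count₂ φ * (b ^ n) ^ n
∏∏-if n φ a b = begin
  ∏∏ n (λ u v → if φ u v then a else b) * b ^ count₂ φ             ≡⟨ cong (∏∏ n _ *_) (∏-^ n b (count ∘ φ)) ⟨
  ∏∏ n (λ u v → if φ u v then a else b) * ∏ n (λ u → b ^ count (φ u)) ≡⟨ ∏-distrib-* n _ _ ⟨
  ∏ n (λ u → ∏ n (λ v → if φ u v then a else b) * b ^ count (φ u)) ≡⟨ ∏-cong n (λ u → ∏-if n (φ u) a b) ⟩
  ∏ n (λ u → a ^ count (φ u) * b ^ n)                             ≡⟨ ∏-distrib-* n _ _ ⟩
  ∏ n (λ u → a ^ count (φ u)) * ∏ n (λ _ → b ^ n)                 ≡⟨ cong₂ _*_ (∏-^ n a (count ∘ φ)) (∏-const n (b ^ n)) ⟩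
  a ^ count₂ φ * (b ^ n) ^ n                                      ∎
  where open ≡-Reasoning

-- F u v satisfies ψ for every (u , v) in φ with probability (|ψ| / n) ^ |φ|.
∑-seeds-∏∏-if : ∀ n (φ : Fin n → Fin n → Bool) (ψ : Fin n → Bool) →
  ∑[ F ← seeds n ] ∏∏ n (λ u v → if φ u v then 𝟙 (ψ (F u v)) else 1) * n ^ count₂ φ
  ≡ count ψ ^ count₂ φ * length (seeds n)
∑-seeds-∏∏-if n φ ψ = begin
  ∑[ F ← seeds n ] ∏∏ n (λ u v → if φ u v then 𝟙 (ψ (F u v)) else 1) * n ^ count₂ φ
      ≡⟨ cong (_* n ^ count₂ φ) (∑-seeds-∏∏ n (λ u v x → if φ u v then 𝟙 (ψ x) else 1)) ⟩
  ∏∏ n (λ u v → ∑[ x ← allFin n ] (if φ u v then 𝟙 (ψ x) else 1)) * n ^ count₂ φ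
      ≡⟨ cong (_* n ^ count₂ φ) (∏-cong n (λ u → ∏-cong n (λ v → ∑-if (φ u v)))) ⟩
  ∏∏ n (λ u v → if φ u v then count ψ else n) * n ^ count₂ φ
      ≡⟨ ∏∏-if n φ (count ψ) n ⟩
  count ψ ^ count₂ φ * (n ^ n) ^ n
      ≡⟨ cong (count ψ ^ count₂ φ *_) (length-seeds n) ⟨
  count ψ ^ count₂ φ * length (seeds n) ∎
  where
  open ≡-Reasoning
  ∑-if : ∀ c → ∑[ x ← allFin n ] (if c then 𝟙 (ψ x) else 1) ≡ (if c then count ψ else n)
  ∑-if true  = refl
  ∑-if false = trans (∑-const (allFin n) 1) (trans (*-identityʳ _) (length-allFin n))

∑-seeds-∏∏-if-≤ : ∀ n .{{_ : NonZero n}} (φ : Fin n → Fin n → Bool) (ψ : Fin n → Bool) e →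
  e ≤ count₂ φ →
  ∑[ F ← seeds n ] ∏∏ n (λ u v → if φ u v then 𝟙 (ψ (F u v)) else 1) * n ^ e
  ≤ count ψ ^ e * length (seeds n)
∑-seeds-∏∏-if-≤ n φ ψ e e≤ = ratio-pow-≤ {a = P} n e (count₂ φ ∸ e) (count≤n ψ)
  (subst (λ c → P * n ^ c ≡ count ψ ^ c * length (seeds n)) (sym (m+[n∸m]≡n e≤)) (∑-seeds-∏∏-if n φ ψ))
  where
  P = ∑[ F ← seeds n ] ∏∏ n (λ u v → if φ u v then 𝟙 (ψ (F u v)) else 1)

-- Each ordered pair is an arc with probability D / n.
arc : ∀ {n} → ℕ → Seed n → Fin n × Fin n → Bool
arc D F (u , v) = toℕ (F u v) <ᵇ D

count-<ᵇ-≤ : ∀ {n D} → D ≤ n → count {n} (λ x → toℕ x <ᵇ D) ≡ D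
count-<ᵇ-≤ {n} {D} D≤n = trans (count-<ᵇ n D) (m≥n⇒m⊓n≡n D≤n)

count-≮ᵇ-≤ : ∀ {n D} → D ≤ n → count {n} (λ x → not (toℕ x <ᵇ D)) ≡ n ∸ D
count-≮ᵇ-≤ {n} {D} D≤n = sym (begin
  n ∸ D                 ≡⟨ cong (_∸ D) (count+count-not p) ⟨
  count p + count (not ∘ p) ∸ D ≡⟨ cong (λ c → c + count (not ∘ p) ∸ D) (count-<ᵇ-≤ {n} D≤n) ⟩
  D + count (not ∘ p) ∸ D       ≡⟨ m+n∸m≡n D _ ⟩
  count (not ∘ p)               ∎)
  where
  open ≡-Reasoning
  p = λ (x : Fin n) → toℕ x <ᵇ D

∑-seeds-no-arc : ∀ n D .{{_ : NonZero n}} → D ≤ n → (p q : Fin n → Bool) (s : ℕ) →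
  s ≤ count p → s ≤ count q →
  ∑[ F ← seeds n ] ∏∏ n (λ u v → if p u ∧ q v then 𝟙 (not (arc D F (u , v))) else 1) * n ^ (s * s)
  ≤ (n ∸ D) ^ (s * s) * length (seeds n)
∑-seeds-no-arc n D D≤n p q s s≤p s≤q = begin
  ∑[ F ← seeds n ] ∏∏ n (λ u v → if p u ∧ q v then 𝟙 (not (arc D F (u , v))) else 1) * n ^ (s * s)
    ≤⟨ ∑-seeds-∏∏-if-≤ n (λ u v → p u ∧ q v) (λ x → not (toℕ x <ᵇ D)) (s * s)
         (subst (s * s ≤_) (sym (count₂-∧ p q)) (*-mono-≤ s≤p s≤q)) ⟩
  count {n} (λ x → not (toℕ x <ᵇ D)) ^ (s * s) * length (seeds n)
    ≡⟨ cong (λ c → c ^ (s * s) * length (seeds n)) (count-≮ᵇ-≤ {n} D≤n) ⟩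
  (n ∸ D) ^ (s * s) * length (seeds n) ∎
  where open ≤-Reasoning

∑-seeds-arcs : ∀ n D {L} .{{_ : NonZero n}} → D ≤ n →
  (κ : Fin L → Fin n × Fin n) → (∀ {a b} → κ a ≡ κ b → a ≡ b) →
  ∑[ F ← seeds n ] ∏ L (λ a → 𝟙 (arc D F (κ a))) * n ^ L ≤ D ^ L * length (seeds n)
∑-seeds-arcs n D {L} D≤n κ κ-inj = begin
  ∑[ F ← seeds n ] ∏ L (λ a → 𝟙 (arc D F (κ a))) * n ^ L
    ≤⟨ *-monoˡ-≤ (n ^ L) (∑-mono (seeds n) λ F → ∏-𝟙≤ L (arc D F ∘ κ) (1≤onImage F)) ⟩
  ∑[ F ← seeds n ] ∏∏ n (λ u v → if image κ u v then 𝟙 (arc D F (u , v)) else 1) * n ^ L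
    ≤⟨ ∑-seeds-∏∏-if-≤ n (image κ) (λ x → toℕ x <ᵇ D) L (≤-reflexive (sym (count₂-image κ κ-inj))) ⟩
  count {n} (λ x → toℕ x <ᵇ D) ^ L * length (seeds n)
    ≡⟨ cong (λ c → c ^ L * length (seeds n)) (count-<ᵇ-≤ {n} D≤n) ⟩
  D ^ L * length (seeds n) ∎
  where
  open ≤-Reasoning
  1≤onImage : ∀ F → (∀ a → arc D F (κ a) ≡ true) →
              1 ≤ ∏∏ n (λ u v → if image κ u v then 𝟙 (arc D F (u , v)) else 1)
  1≤onImage F all = 1≤∏ n λ u → 1≤∏ n λ v → factor u v
    where
    factor : ∀ u v → 1 ≤ (if image κ u v then 𝟙 (arc D F (u , v)) else 1)
    factor u v with image κ u v in im
    ... | false = ≤-refl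
    ... | true with any-true⁻ (λ a → ⁅ κ a ⁆₂ u v) (allFin L) im
    ...   | a , at = ≤-reflexive (sym (cong 𝟙 (subst (λ p → arc D F p ≡ true) (sym (⁅⁆₂-true⁻ (κ a) at)) (all a))))

next : ∀ {M} → Fin (suc M) → Fin (suc M)
next {M} a with M ≟ℕ toℕ a
... | yes _   = zero
... | no  M≢a = suc (lower₁ a M≢a)

toℕ-next : ∀ {M} (a : Fin (suc M)) → (toℕ a ≡ M × toℕ (next a) ≡ 0) ⊎ toℕ (next a) ≡ suc (toℕ a)
toℕ-next {M} a with M ≟ℕ toℕ a
... | yes M≡a = inj₁ (sym M≡a , refl)
... | no  M≢a = inj₂ (cong suc (Finₚ.toℕ-lower₁ a M≢a))

next∘next≢id : ∀ {M} (a : Fin (3 + M)) → next (next a) ≢ a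
next∘next≢id a eq with toℕ-next a | toℕ-next (next a) | cong toℕ eq
... | inj₂ a↦ | inj₂ na↦ | nna≡a = <-irrefl (trans (sym nna≡a) (trans na↦ (cong suc a↦))) (<-trans (n<1+n _) (n<1+n _))
... | inj₁ (a≡M , na≡0) | inj₂ na↦ | nna≡a =
  contradiction (trans (sym a≡M) (trans (sym nna≡a) (trans na↦ (cong suc na≡0)))) λ ()
... | inj₁ (_ , na≡0) | inj₁ (na≡M , _) | _ =
  contradiction (trans (sym na≡0) na≡M) λ ()
... | inj₂ a↦ | inj₁ (na≡M , nna≡0) | nna≡a =
  contradiction (trans (sym na≡M) (trans a↦ (cong suc (trans (sym nna≡a) nna≡0)))) λ ()

orient : ∀ {M n} → (Fin (suc M) → Fin n) → (Fin (suc M) → Bool) → Fin (suc M) → Fin n × Fin n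
orient c w a = if w a then (c a , c (next a)) else (c (next a) , c a)

orient-injective : ∀ {M n} (c : Fin (3 + M) → Fin n) (w : Fin (3 + M) → Bool) →
                   (∀ a b → c a ≡ c b → a ≡ b) → ∀ {a b} → orient c w a ≡ orient c w b → a ≡ b
orient-injective c w c-inj {a} {b} eq with w a | w b
... | true  | true  = c-inj a b (cong proj₁ eq)
... | false | false = c-inj a b (cong proj₂ eq)
... | true  | false = ⊥-elim (next∘next≢id b
      (trans (cong next (sym (c-inj _ _ (cong proj₁ eq)))) (c-inj _ _ (cong proj₂ eq))))
... | false | true  = ⊥-elim (next∘next≢id a
      (trans (cong next (c-inj _ _ (cong proj₁ eq))) (sym (c-inj _ _ (cong proj₂ eq)))))

IsCycle : ∀ {n M} → (Fin n → Fin n → Bool) → (Fin (suc M) → Fin n) → Set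
IsCycle E c = (∀ a b → c a ≡ c b → a ≡ b) × (∀ a → E (c a) (c (next a)) ≡ true)

injective? : ∀ {n M} (c : Fin M → Fin n) → Dec (∀ a b → c a ≡ c b → a ≡ b)
injective? c = all? λ a → all? λ b → c a ≟ c b →-dec a ≟ b

isCycle? : ∀ {n M} (E : Fin n → Fin n → Bool) (c : Fin (suc M) → Fin n) → Dec (IsCycle E c)
isCycle? E c = injective? c ×-dec all? (λ a → E (c a) (c (next a)) ≟ᵇ true)

IsCycle-mono : ∀ {n M} {E E′ : Fin n → Fin n → Bool} {c : Fin (suc M) → Fin n} →
               (∀ u v → E u v ≡ true → E′ u v ≡ true) → IsCycle E c → IsCycle E′ c
IsCycle-mono E⊆E′ (c-inj , c-adj) = c-inj , λ a → E⊆E′ _ _ (c-adj a)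

IsCycle-≗ : ∀ {n M} {E : Fin n → Fin n → Bool} {c c′ : Fin (suc M) → Fin n} →
            (∀ a → c′ a ≡ c a) → IsCycle E c → IsCycle E c′
IsCycle-≗ {E = E} c′≗c (c-inj , c-adj) =
  (λ a b eq → c-inj a b (trans (sym (c′≗c a)) (trans eq (c′≗c b)))) ,
  (λ a → subst₂ (λ x y → E x y ≡ true) (sym (c′≗c a)) (sym (c′≗c (next a))) (c-adj a))

HasCycleOfLength3+⇒IsCycle : ∀ {G m} → HasCycleOfLength3+ G m → ∃ (IsCycle (adj G))
HasCycleOfLength3+⇒IsCycle {G} {m} (c , c-inj , c-adj , c-close) = c , (λ _ _ → c-inj) , along
  where
  along : ∀ a → adj G (c a) (c (next a)) ≡ true
  along a with 2 + m ≟ℕ toℕ a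
  ... | yes M≡a = subst (λ x → adj G (c x) (c zero) ≡ true)
                        (Finₚ.toℕ-injective (trans (Finₚ.toℕ-fromℕ _) M≡a)) c-close
  ... | no  M≢a = subst (λ x → adj G (c x) (c (suc (lower₁ a M≢a))) ≡ true)
                        (Finₚ.inject₁-lower₁ a M≢a) (c-adj (lower₁ a M≢a))

HasCycleOfLength3+-map : ∀ {H G m} (f : Fin (size H) → Fin (size G)) → (∀ {x y} → f x ≡ f y → x ≡ y) →
  (∀ x y → adj H x y ≡ true → adj G (f x) (f y) ≡ true) → HasCycleOfLength3+ H m → HasCycleOfLength3+ G m
HasCycleOfLength3+-map f f-inj f-adj (c , c-inj , c-adj , c-close) =
  f ∘ c , c-inj ∘ f-inj , (λ i → f-adj _ _ (c-adj i)) , f-adj _ _ c-close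

completePair⇒C₄ : ∀ G (P Q : Fin (size G) → Bool) →
  (∀ v → P v ≡ true → Q v ≡ true → ⊥) → (∀ u v → P u ≡ true → Q v ≡ true → adj G u v ≡ true) →
  1 < count P → 1 < count Q → HasCycleOfLength3+ G 1
completePair⇒C₄ G P Q disjoint complete 1<P 1<Q
  with 1<count⇒∃₂ P 1<P | 1<count⇒∃₂ Q 1<Q
... | p₁ , p₂ , Pp₁ , Pp₂ , p₁≢p₂ | q₁ , q₂ , Qq₁ , Qq₂ , q₁≢q₂ = c , c-inj , c-adj , c-close
  where
  c : Fin 4 → Fin (size G)
  c zero                   = p₁
  c (suc zero)             = q₁
  c (suc (suc zero))       = p₂
  c (suc (suc (suc zero))) = q₂
  _≢ᴾᵠ_ : ∀ {p q} → P p ≡ true → Q q ≡ true → p ≢ q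
  (Pp ≢ᴾᵠ Qq) refl = disjoint _ Pp Qq
  c-inj : ∀ {a b} → c a ≡ c b → a ≡ b
  c-inj {zero}                   {zero}                   _  = refl
  c-inj {zero}                   {suc zero}               eq = ⊥-elim ((Pp₁ ≢ᴾᵠ Qq₁) eq)
  c-inj {zero}                   {suc (suc zero)}         eq = ⊥-elim (p₁≢p₂ eq)
  c-inj {zero}                   {suc (suc (suc zero))}   eq = ⊥-elim ((Pp₁ ≢ᴾᵠ Qq₂) eq)
  c-inj {suc zero}               {zero}                   eq = ⊥-elim ((Pp₁ ≢ᴾᵠ Qq₁) (sym eq))
  c-inj {suc zero}               {suc zero}               _  = refl
  c-inj {suc zero}               {suc (suc zero)}         eq = ⊥-elim ((Pp₂ ≢ᴾᵠ Qq₁) (sym eq))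
  c-inj {suc zero}               {suc (suc (suc zero))}   eq = ⊥-elim (q₁≢q₂ eq)
  c-inj {suc (suc zero)}         {zero}                   eq = ⊥-elim (p₁≢p₂ (sym eq))
  c-inj {suc (suc zero)}         {suc zero}               eq = ⊥-elim ((Pp₂ ≢ᴾᵠ Qq₁) eq)
  c-inj {suc (suc zero)}         {suc (suc zero)}         _  = refl
  c-inj {suc (suc zero)}         {suc (suc (suc zero))}   eq = ⊥-elim ((Pp₂ ≢ᴾᵠ Qq₂) eq)
  c-inj {suc (suc (suc zero))}   {zero}                   eq = ⊥-elim ((Pp₁ ≢ᴾᵠ Qq₂) (sym eq))
  c-inj {suc (suc (suc zero))}   {suc zero}               eq = ⊥-elim (q₁≢q₂ (sym eq))
  c-inj {suc (suc (suc zero))}   {suc (suc zero)}         eq = ⊥-elim ((Pp₂ ≢ᴾᵠ Qq₂) (sym eq))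
  c-inj {suc (suc (suc zero))}   {suc (suc (suc zero))}   _  = refl
  c-adj : ∀ (i : Fin 3) → adj G (c (inject₁ i)) (c (suc i)) ≡ true
  c-adj zero             = complete p₁ q₁ Pp₁ Qq₁
  c-adj (suc zero)       = trans (Graph.sym G q₁ p₂) (complete p₂ q₁ Pp₂ Qq₁)
  c-adj (suc (suc zero)) = complete p₂ q₂ Pp₂ Qq₂
  c-close : adj G q₂ p₁ ≡ true
  c-close = trans (Graph.sym G q₂ p₁) (complete p₁ q₂ Pp₁ Qq₂)

-- Deleting short cycles

bools : List Bool
bools = true ∷ false ∷ []

∈-bools : ∀ b → b ∈ bools
∈-bools true  = here refl
∈-bools false = there (here refl)

-- Every cycle of the underlying graph has an orientation whose arcs are all present, and
-- the arcs of an orientation of an injective cycle are distinct pairs, hence independent.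
orientedCycles : ∀ {n} (D j : ℕ) → Seed n → ℕ
orientedCycles {n} D j F =
  ∑[ c ← functions (3 + j) (allFin n) ]
    (𝟙 (does (injective? c)) * ∑[ w ← functions (3 + j) bools ] ∏ (3 + j) (λ a → 𝟙 (arc D F (orient c w a))))

orientedShortCycles : ∀ {n} (D k : ℕ) → Seed n → ℕ
orientedShortCycles D k F = ∑[ j ← upTo k ] orientedCycles D j F

arcFree : ∀ {n} (D s : ℕ) → Seed n → (p q : Fin n → Bool) → ℕ
arcFree {n} D s F p q =
  𝟙 ((s ≤ᵇ count p) ∧ (s ≤ᵇ count q)) * ∏∏ n (λ u v → if p u ∧ q v then 𝟙 (not (arc D F (u , v))) else 1)

arcFreePairs : ∀ {n} (D s : ℕ) → Seed n → ℕ
arcFreePairs {n} D s F = ∑[ p ← functions n bools ] ∑[ q ← functions n bools ] arcFree D s F p q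

ShortCycleFree : ℕ → Graph → Set
ShortCycleFree k G = ∀ j → j < k → ¬ HasCycleOfLength3+ G j

NoLinearHomogeneousPair : ℕ → Graph → Set
NoLinearHomogeneousPair m G = ∀ P Q → Homogeneous G P Q → size G ≤ suc m * ∣ P ∣ → size G ≤ suc m * ∣ Q ∣ → ⊥

-- Deleted vertices are kept as isolated vertices, so the graph still has n vertices.
module Deletion {n : ℕ} (D k : ℕ) (F : Seed n) where

  edge : Fin n → Fin n → Bool
  edge u v = not (does (u ≟ v)) ∧ (arc D F (u , v) ∨ arc D F (v , u))

  startsShortCycle : Fin n → Bool
  startsShortCycle v = any (λ j → any (λ c → does (isCycle? edge c) ∧ does (v ≟ c zero))
                                      (functions (3 + j) (allFin n)))
                           (upTo k)

  kept : Fin n → Bool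
  kept v = not (startsShortCycle v)

  private
    adj′ : Fin n → Fin n → Bool
    adj′ u v = edge u v ∧ (kept u ∧ kept v)

    adj′-sym : ∀ u v → adj′ u v ≡ adj′ v u
    adj′-sym u v = cong₂ _∧_
      (cong₂ _∧_ (cong not (does-⇔ (mk⇔ sym sym) (u ≟ v) (v ≟ u))) (∨-comm (arc D F (u , v)) _))
      (∧-comm (kept u) (kept v))

    adj′⇒edge : ∀ u v → adj′ u v ≡ true → edge u v ≡ true
    adj′⇒edge u v e = proj₁ (∧≡true⁻ {edge u v} e)

    adj′⇒kept : ∀ u v → adj′ u v ≡ true → kept u ≡ true
    adj′⇒kept u v e = proj₁ (∧≡true⁻ {kept u} (proj₂ (∧≡true⁻ {edge u v} e)))

    adj′-irrefl : ∀ u → adj′ u u ≡ false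
    adj′-irrefl u with u ≟ u
    ... | yes _   = refl
    ... | no  u≢u = contradiction refl u≢u

  graph : Graph
  graph = record { size = n ; adj = adj′ ; sym = adj′-sym ; irref = adj′-irrefl }

  graph-shortCycle-free : ShortCycleFree k graph
  graph-shortCycle-free j j<k cyc with HasCycleOfLength3+⇒IsCycle {graph} cyc
  ... | c , c-cycle@(_ , c-adj) with functions-complete (3 + j) ∈-allFin c
  ...   | c′ , c′∈ , c′≗c = contradiction (trans (cong not (sym starts)) kept-c₀) λ ()
    where
    kept-c₀ : kept (c zero) ≡ true
    kept-c₀ = adj′⇒kept (c zero) (c (next zero)) (c-adj zero)
    c′-cycle : IsCycle edge c′
    c′-cycle = IsCycle-≗ {E = edge} c′≗c (IsCycle-mono adj′⇒edge c-cycle)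
    starts : startsShortCycle (c zero) ≡ true
    starts = any-true⁺ _ (∈-upTo⁺ j<k) (any-true⁺ _ c′∈
               (cong₂ _∧_ (dec-true (isCycle? edge c′) c′-cycle) (dec-true (c zero ≟ c′ zero) (sym (c′≗c zero)))))

  private
    oriented-arc : ∀ {M} (c : Fin (suc M) → Fin n) (w : Fin (suc M) → Bool) a →
                   edge (c a) (c (next a)) ≡ true → w a ≡ arc D F (c a , c (next a)) →
                   arc D F (orient c w a) ≡ true
    oriented-arc c w a e wa with w a | arc D F (c a , c (next a)) in arc₀ | wa
    ... | true  | true  | _ = arc₀
    ... | false | false | _ with arc D F (c (next a) , c a) | proj₂ (∧≡true⁻ {not (does (c a ≟ c (next a)))} e)
    ...   | true | _ = refl

    cycle≤orientations : ∀ j (c : Fin (3 + j) → Fin n) →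
      𝟙 (does (isCycle? edge c)) ≤
      𝟙 (does (injective? c)) * ∑[ w ← functions (3 + j) bools ] ∏ (3 + j) (λ a → 𝟙 (arc D F (orient c w a)))
    cycle≤orientations j c = bound (isCycle? edge c)
      where
      orientations : ℕ
      orientations = ∑[ w ← functions (3 + j) bools ] ∏ (3 + j) (λ a → 𝟙 (arc D F (orient c w a)))
      bound : (d : Dec (IsCycle edge c)) → 𝟙 (does d) ≤ 𝟙 (does (injective? c)) * orientations
      bound (no _)                = z≤n
      bound (yes (c-inj , c-edge)) with functions-complete (3 + j) ∈-bools (λ a → arc D F (c a , c (next a)))
      ... | w , w∈ , w≗ = begin
        1                                              ≡⟨ ∏-𝟙-true (3 + j) _ (λ a → oriented-arc c w a (c-edge a) (w≗ a)) ⟨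
        ∏ (3 + j) (λ a → 𝟙 (arc D F (orient c w a)))   ≤⟨ ∈⇒≤∑ (λ w → ∏ (3 + j) (λ a → 𝟙 (arc D F (orient c w a)))) w∈ ⟩
        orientations                                   ≡⟨ +-identityʳ _ ⟨
        1 * orientations                               ≡⟨ cong (λ b → 𝟙 b * orientations) (dec-true (injective? c) c-inj) ⟨
        𝟙 (does (injective? c)) * orientations         ∎
        where open ≤-Reasoning

  count-startsShortCycle≤ : count startsShortCycle ≤ orientedShortCycles D k F
  count-startsShortCycle≤ = begin
    count startsShortCycle
      ≤⟨ ∑-mono (allFin n) (λ v → ≤-trans (𝟙-any≤∑ _ (upTo k)) (∑-mono (upTo k) (λ j → 𝟙-any≤∑ _ (cs j)))) ⟩
    ∑[ v ← allFin n ] ∑[ j ← upTo k ] ∑[ c ← cs j ] 𝟙 (isCycle c ∧ does (v ≟ c zero))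
      ≡⟨ ∑-comm (allFin n) (upTo k) _ ⟩
    ∑[ j ← upTo k ] ∑[ v ← allFin n ] ∑[ c ← cs j ] 𝟙 (isCycle c ∧ does (v ≟ c zero))
      ≡⟨ ∑-cong (upTo k) (λ j → ∑-comm (allFin n) (cs j) _) ⟩
    ∑[ j ← upTo k ] ∑[ c ← cs j ] count (λ v → isCycle c ∧ does (v ≟ c zero))
      ≡⟨ ∑-cong (upTo k) (λ j → ∑-cong (cs j) (λ c →
           trans (count-∧ˡ (isCycle c) (λ v → does (v ≟ c zero))) (trans (cong (𝟙 (isCycle c) *_) (count-≡ (c zero))) (*-identityʳ _)))) ⟩
    ∑[ j ← upTo k ] ∑[ c ← cs j ] 𝟙 (isCycle c)
      ≤⟨ ∑-mono (upTo k) (λ j → ∑-mono (cs j) (cycle≤orientations j)) ⟩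
    orientedShortCycles D k F ∎
    where
    open ≤-Reasoning
    cs : ∀ j → List (Fin (3 + j) → Fin n)
    cs j = functions (3 + j) (allFin n)
    isCycle : ∀ {j} → (Fin (3 + j) → Fin n) → Bool
    isCycle c = does (isCycle? edge c)

  2*s≤⇒s≤count-kept : ∀ {s} (R : Fin n → Bool) → count startsShortCycle ≤ s → 2 * s ≤ count R →
                      s ≤ count (λ u → R u ∧ kept u)
  2*s≤⇒s≤count-kept {s} R deleted≤s 2s≤R = +-cancelʳ-≤ s s _ (begin
    s + s                                                ≡⟨ cong (s +_) (+-identityʳ s) ⟨
    2 * s                                                ≤⟨ 2s≤R ⟩
    count R                                              ≤⟨ count≤count-∧-not+count R startsShortCycle ⟩
    count (λ u → R u ∧ kept u) + count startsShortCycle  ≤⟨ +-monoʳ-≤ _ deleted≤s ⟩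
    count (λ u → R u ∧ kept u) + s                       ∎)
    where open ≤-Reasoning

  nonadjacent⇒no-arc : ∀ {u v} → u ≢ v → adj graph u v ≡ false → kept u ≡ true → kept v ≡ true →
                       arc D F (u , v) ≡ false
  nonadjacent⇒no-arc {u} {v} u≢v nonadjacent ku kv =
    ∨≡false⇒ˡ (∧≡false⇒ʳ (∧≡false⇒ˡ nonadjacent (cong₂ _∧_ ku kv)) (cong not (dec-false (u ≟ v) u≢v)))

  0<arcFreePairs : ∀ s (P Q : Fin n → Bool) → (∀ v → P v ≡ true → Q v ≡ true → ⊥) →
    (∀ u v → P u ≡ true → Q v ≡ true → adj graph u v ≡ false) →
    count startsShortCycle ≤ s → 2 * s ≤ count P → 2 * s ≤ count Q → 0 < arcFreePairs D s F
  0<arcFreePairs s P Q disjoint anticomplete deleted≤s 2s≤P 2s≤Q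
    with functions-complete n ∈-bools (λ u → P u ∧ kept u) | functions-complete n ∈-bools (λ u → Q u ∧ kept u)
  ... | p , p∈ , p≗ | q , q∈ , q≗ = begin
    1                                                 ≤⟨ 1≤arcFree ⟩
    arcFree D s F p q                                 ≤⟨ ∈⇒≤∑ (arcFree D s F p) q∈ ⟩
    ∑[ q ← functions n bools ] arcFree D s F p q      ≤⟨ ∈⇒≤∑ (λ p → ∑[ q ← functions n bools ] arcFree D s F p q) p∈ ⟩
    arcFreePairs D s F                                ∎
    where
    open ≤-Reasoning
    s≤ᵇcount : ∀ {R} (r : Fin n → Bool) → (∀ u → r u ≡ (R u ∧ kept u)) → 2 * s ≤ count R → (s ≤ᵇ count r) ≡ true
    s≤ᵇcount {R} r r≗ 2s≤R = Equivalence.to T-≡ (≤⇒≤ᵇ (subst (s ≤_)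
      (∑-cong (allFin n) (λ u → cong 𝟙 (sym (r≗ u)))) (2*s≤⇒s≤count-kept R deleted≤s 2s≤R)))
    no-arc : ∀ u v → p u ∧ q v ≡ true → arc D F (u , v) ≡ false
    no-arc u v pq with ∧≡true⁻ pq
    ... | pu , qv with ∧≡true⁻ (trans (sym (p≗ u)) pu) | ∧≡true⁻ (trans (sym (q≗ v)) qv)
    ...   | Pu , ku | Qv , kv = nonadjacent⇒no-arc (λ { refl → disjoint u Pu Qv }) (anticomplete u v Pu Qv) ku kv
    1≤arcFree : 1 ≤ arcFree D s F p q
    1≤arcFree rewrite s≤ᵇcount p p≗ 2s≤P | s≤ᵇcount q q≗ 2s≤Q =
      ≤-trans (1≤∏ n λ u → 1≤∏ n λ v → factor u v) (≤-reflexive (sym (+-identityʳ _)))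
      where
      factor : ∀ u v → 1 ≤ (if p u ∧ q v then 𝟙 (not (arc D F (u , v))) else 1)
      factor u v with p u ∧ q v in pq
      ... | false = ≤-refl
      ... | true  rewrite no-arc u v pq = ≤-refl

  noLinearHomogeneousPair : ∀ m s → 1 < k → 1 ≤ s → (∀ {c} → n ≤ suc m * c → 2 * s ≤ c) →
    arcFreePairs D s F ≡ 0 → orientedShortCycles D k F ≤ s → NoLinearHomogeneousPair m graph
  noLinearHomogeneousPair m s 1<k 1≤s 2*s≤ noArcFreePair fewShortCycles = noPair
    where
    2*s≤count : ∀ P → n ≤ suc m * ∣ P ∣ → 2 * s ≤ count (lookup P)
    2*s≤count P n≤P = subst (2 * s ≤_) (∣p∣≡count P) (2*s≤ n≤P)
    noPair : NoLinearHomogeneousPair m graph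
    noPair P Q (disjoint , inj₁ complete) n≤P n≤Q = graph-shortCycle-free 1 1<k
      (completePair⇒C₄ graph (lookup P) (lookup Q)
        (λ v Pv Qv → disjoint v (lookup⇒[]= v P Pv) (lookup⇒[]= v Q Qv))
        (λ u v Pu Qv → complete u v (lookup⇒[]= u P Pu) (lookup⇒[]= v Q Qv))
        (≤-trans (*-monoʳ-≤ 2 1≤s) (2*s≤count P n≤P)) (≤-trans (*-monoʳ-≤ 2 1≤s) (2*s≤count Q n≤Q)))
    noPair P Q (disjoint , inj₂ anticomplete) n≤P n≤Q = <⇒≢
      (0<arcFreePairs s (lookup P) (lookup Q)
        (λ v Pv Qv → disjoint v (lookup⇒[]= v P Pv) (lookup⇒[]= v Q Qv))
        (λ u v Pu Qv → anticomplete u v (lookup⇒[]= u P Pu) (lookup⇒[]= v Q Qv))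
        (≤-trans count-startsShortCycle≤ fewShortCycles) (2*s≤count P n≤P) (2*s≤count Q n≤Q))
      (sym noArcFreePair)

-- Expectations

∑-seeds-orientations : ∀ n D {j} .{{_ : NonZero n}} → D ≤ n → (c : Fin (3 + j) → Fin n) →
  (∀ a b → c a ≡ c b → a ≡ b) →
  (∑[ F ← seeds n ] ∑[ w ← functions (3 + j) bools ] ∏ (3 + j) (λ a → 𝟙 (arc D F (orient c w a)))) * n ^ (3 + j)
  ≤ (2 * D) ^ (3 + j) * length (seeds n)
∑-seeds-orientations n D {j} D≤n c c-inj = begin
  (∑[ F ← seeds n ] ∑[ w ← ws ] arcsPresent F w) * n ^ L ≡⟨ cong (_* n ^ L) (∑-comm (seeds n) ws _) ⟩
  (∑[ w ← ws ] ∑[ F ← seeds n ] arcsPresent F w) * n ^ L ≡⟨ *-distribʳ-∑ (n ^ L) ws _ ⟩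
  ∑[ w ← ws ] ((∑[ F ← seeds n ] arcsPresent F w) * n ^ L)
    ≤⟨ ∑≤length* ws (λ w → ∑-seeds-arcs n D D≤n (orient c w) (orient-injective c w c-inj)) ⟩
  length ws * (D ^ L * T)                                ≡⟨ cong (_* (D ^ L * T)) (length-functions L bools) ⟩
  2 ^ L * (D ^ L * T)                                    ≡⟨ trans (cong (_* T) (^-distribʳ-* 2 D L)) (*-assoc (2 ^ L) _ _) ⟨
  (2 * D) ^ L * T                                        ∎
  where
  open ≤-Reasoning
  L = 3 + j
  ws = functions L bools
  T = length (seeds n)
  arcsPresent : Seed n → (Fin L → Bool) → ℕ
  arcsPresent F w = ∏ L (λ a → 𝟙 (arc D F (orient c w a)))

∑-seeds-orientedCycles : ∀ n D j .{{_ : NonZero n}} → D ≤ n →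
  ∑[ F ← seeds n ] orientedCycles D j F ≤ (2 * D) ^ (3 + j) * length (seeds n)
∑-seeds-orientedCycles n D j D≤n = begin
  ∑[ F ← seeds n ] orientedCycles D j F                   ≡⟨ ∑-comm (seeds n) cs _ ⟩
  ∑[ c ← cs ] ∑[ F ← seeds n ] weight F c                 ≤⟨ ∑-averaging cs _ {{m^n≢0 n L}} ∣cs∣ per-cycle ⟩
  (2 * D) ^ L * length (seeds n)                          ∎
  where
  open ≤-Reasoning
  L = 3 + j
  cs = functions L (allFin n)
  orientations : Seed n → (Fin L → Fin n) → ℕ
  orientations F c = ∑[ w ← functions L bools ] ∏ L (λ a → 𝟙 (arc D F (orient c w a)))
  weight : Seed n → (Fin L → Fin n) → ℕ
  weight F c = 𝟙 (does (injective? c)) * orientations F c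
  ∣cs∣ : length cs ≡ n ^ L
  ∣cs∣ = trans (length-functions L (allFin n)) (cong (_^ L) (length-allFin n))
  per-cycle : ∀ c → (∑[ F ← seeds n ] weight F c) * n ^ L ≤ (2 * D) ^ L * length (seeds n)
  per-cycle c = weigh (injective? c)
    where
    weigh : (d : Dec (∀ a b → c a ≡ c b → a ≡ b)) →
            (∑[ F ← seeds n ] (𝟙 (does d) * orientations F c)) * n ^ L ≤ (2 * D) ^ L * length (seeds n)
    weigh (no _)      = ≤-trans (≤-reflexive (cong (_* n ^ L) (∑-zero (seeds n)))) z≤n
    weigh (yes c-inj) = subst (λ x → x * n ^ L ≤ (2 * D) ^ L * length (seeds n))
                              (∑-cong (seeds n) (λ F → sym (*-identityˡ _))) (∑-seeds-orientations n D D≤n c c-inj)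

∑-seeds-orientedShortCycles : ∀ n D k .{{_ : NonZero n}} → D ≤ n →
  ∑[ F ← seeds n ] orientedShortCycles D k F ≤ (∑[ j ← upTo k ] ((2 * D) ^ (3 + j))) * length (seeds n)
∑-seeds-orientedShortCycles n D k D≤n = begin
  ∑[ F ← seeds n ] ∑[ j ← upTo k ] orientedCycles D j F  ≡⟨ ∑-comm (seeds n) (upTo k) _ ⟩
  ∑[ j ← upTo k ] ∑[ F ← seeds n ] orientedCycles D j F  ≤⟨ ∑-mono (upTo k) (λ j → ∑-seeds-orientedCycles n D j D≤n) ⟩
  ∑[ j ← upTo k ] ((2 * D) ^ (3 + j) * length (seeds n)) ≡⟨ *-distribʳ-∑ _ (upTo k) _ ⟨
  (∑[ j ← upTo k ] ((2 * D) ^ (3 + j))) * length (seeds n) ∎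
  where open ≤-Reasoning

∑-seeds-arcFreePairs : ∀ n D s .{{_ : NonZero n}} → D ≤ n →
  (∑[ F ← seeds n ] arcFreePairs D s F) * n ^ (s * s) ≤ 4 ^ n * (n ∸ D) ^ (s * s) * length (seeds n)
∑-seeds-arcFreePairs n D s D≤n = begin
  (∑[ F ← seeds n ] ∑[ p ← ps ] ∑[ q ← ps ] arcFree D s F p q) * n ^ (s * s)
    ≡⟨ cong (_* n ^ (s * s)) (trans (∑-comm (seeds n) ps _) (∑-cong ps (λ p → ∑-comm (seeds n) ps _))) ⟩
  (∑[ p ← ps ] ∑[ q ← ps ] ∑[ F ← seeds n ] arcFree D s F p q) * n ^ (s * s)
    ≡⟨ trans (*-distribʳ-∑ _ ps _) (∑-cong ps (λ p → *-distribʳ-∑ _ ps _)) ⟩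
  ∑[ p ← ps ] ∑[ q ← ps ] ((∑[ F ← seeds n ] arcFree D s F p q) * n ^ (s * s))
    ≤⟨ ∑≤length* ps (λ p → ∑≤length* ps (λ q → per-pair p q)) ⟩
  length ps * (length ps * bound)
    ≡⟨ trans (sym (*-assoc (length ps) _ bound)) (cong (_* bound) ∣ps∣²) ⟩
  4 ^ n * bound
    ≡⟨ *-assoc (4 ^ n) _ _ ⟨
  4 ^ n * (n ∸ D) ^ (s * s) * length (seeds n) ∎
  where
  open ≤-Reasoning
  ps = functions n bools
  bound = (n ∸ D) ^ (s * s) * length (seeds n)
  ∣ps∣² : length ps * length ps ≡ 4 ^ n
  ∣ps∣² = trans (cong₂ _*_ (length-functions n bools) (length-functions n bools)) (sym (^-distribʳ-* 2 2 n))
  per-pair : ∀ p q → (∑[ F ← seeds n ] arcFree D s F p q) * n ^ (s * s) ≤ bound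
  per-pair p q with (s ≤ᵇ count p) ∧ (s ≤ᵇ count q) in large
  ... | false = ≤-trans (≤-reflexive (cong (_* n ^ (s * s)) (∑-zero (seeds n)))) z≤n
  ... | true  with ∧≡true⁻ large
  ...   | s≤ᵇp , s≤ᵇq = subst (λ x → x * n ^ (s * s) ≤ bound) (∑-cong (seeds n) (λ F → sym (*-identityˡ _)))
          (∑-seeds-no-arc n D D≤n p q s (≤ᵇ⇒≤ s _ (Equivalence.from T-≡ s≤ᵇp)) (≤ᵇ⇒≤ s _ (Equivalence.from T-≡ s≤ᵇq)))

bernoulli : ∀ a j → a ^ j * (a + j) ≤ a * suc a ^ j
bernoulli a zero    = ≤-reflexive (trans (*-identityˡ (a + 0)) (trans (+-identityʳ a) (sym (*-identityʳ a))))
bernoulli a (suc j) = begin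
  a * a ^ j * (a + suc j)   ≡⟨ reassoc₁ a (a ^ j) j ⟩
  a ^ j * (a * (a + suc j)) ≤⟨ *-monoʳ-≤ (a ^ j) (≤-reflexive-+ (a * (a + suc j)) j (expand a j)) ⟩
  a ^ j * ((a + j) * suc a) ≡⟨ *-assoc (a ^ j) (a + j) (suc a) ⟨
  a ^ j * (a + j) * suc a   ≤⟨ *-monoˡ-≤ (suc a) (bernoulli a j) ⟩
  a * suc a ^ j * suc a     ≡⟨ reassoc₂ a (suc a ^ j) (suc a) ⟩
  a * (suc a * suc a ^ j)   ∎
  where
  open ≤-Reasoning
  reassoc₁ : ∀ a p j → a * p * (a + suc j) ≡ p * (a * (a + suc j))
  reassoc₁ = solve-∀
  reassoc₂ : ∀ a p b → a * p * b ≡ a * (b * p)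
  reassoc₂ = solve-∀
  expand : ∀ a j → a * (a + suc j) + j ≡ (a + j) * suc a
  expand = solve-∀
  ≤-reflexive-+ : ∀ x y {z} → x + y ≡ z → x ≤ z
  ≤-reflexive-+ x y refl = m≤m+n x y

2*a^[1+a]≤[1+a]^[1+a] : ∀ a → 2 * a ^ suc a ≤ suc a ^ suc a
2*a^[1+a]≤[1+a]^[1+a] zero      = z≤n
2*a^[1+a]≤[1+a]^[1+a] a@(suc _) = *-cancelˡ-≤ a (begin
  a * (2 * a ^ suc a)       ≡⟨ reassoc a (a ^ suc a) ⟩
  a ^ suc a * (a + a)       ≤⟨ *-monoʳ-≤ (a ^ suc a) (+-monoʳ-≤ a (n≤1+n a)) ⟩
  a ^ suc a * (a + suc a)   ≤⟨ bernoulli a (suc a) ⟩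
  a * suc a ^ suc a         ∎)
  where
  open ≤-Reasoning
  reassoc : ∀ a p → a * (2 * p) ≡ p * (a + a)
  reassoc = solve-∀

2*4^n≤16^n : ∀ n .{{_ : NonZero n}} → 2 * 4 ^ n ≤ 2 ^ (4 * n)
2*4^n≤16^n n@(suc _) = begin
  2 * 4 ^ n        ≤⟨ *-monoˡ-≤ (4 ^ n) (≤-trans (s≤s (s≤s z≤n)) (^-monoʳ-≤ 4 {1} {n} (s≤s z≤n))) ⟩
  4 ^ n * 4 ^ n    ≡⟨ ^-distribʳ-* 4 4 n ⟨
  (2 ^ 4) ^ n      ≡⟨ ^-*-assoc 2 4 n ⟩
  2 ^ (4 * n)      ∎
  where open ≤-Reasoning

2*4^n*[cK]^e≤[c[1+K]]^e : ∀ c K n .{{_ : NonZero n}} →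
  2 * (4 ^ n * (c * K) ^ (suc K * (4 * n))) ≤ (c * suc K) ^ (suc K * (4 * n))
2*4^n*[cK]^e≤[c[1+K]]^e c K n = begin
  2 * (4 ^ n * (c * K) ^ e)                 ≡⟨ trans (sym (*-assoc 2 (4 ^ n) _)) (cong (2 * 4 ^ n *_) (^-distribʳ-* c K e)) ⟩
  2 * 4 ^ n * (c ^ e * K ^ e)               ≤⟨ *-monoˡ-≤ _ (2*4^n≤16^n n) ⟩
  2 ^ (4 * n) * (c ^ e * K ^ e)             ≡⟨ x*[y*z]≡y*[x*z] (2 ^ (4 * n)) (c ^ e) (K ^ e) ⟩
  c ^ e * (2 ^ (4 * n) * K ^ e)             ≡⟨ cong (λ x → c ^ e * (2 ^ (4 * n) * x)) (^-*-assoc K (suc K) (4 * n)) ⟨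
  c ^ e * (2 ^ (4 * n) * (K ^ suc K) ^ (4 * n)) ≡⟨ cong (c ^ e *_) (^-distribʳ-* 2 (K ^ suc K) (4 * n)) ⟨
  c ^ e * (2 * K ^ suc K) ^ (4 * n)         ≤⟨ *-monoʳ-≤ (c ^ e) (^-monoˡ-≤ (4 * n) (2*a^[1+a]≤[1+a]^[1+a] K)) ⟩
  c ^ e * (suc K ^ suc K) ^ (4 * n)         ≡⟨ cong (c ^ e *_) (^-*-assoc (suc K) (suc K) (4 * n)) ⟩
  c ^ e * suc K ^ e                         ≡⟨ ^-distribʳ-* c (suc K) e ⟨
  (c * suc K) ^ e                           ∎
  where
  open ≤-Reasoning
  e = suc K * (4 * n)
  x*[y*z]≡y*[x*z] : ∀ x y z → x * (y * z) ≡ y * (x * z)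
  x*[y*z]≡y*[x*z] = solve-∀

2*≤-cancel : ∀ {x y N T} .{{_ : NonZero N}} → x * N ≤ y * T → 2 * y ≤ N → 2 * x ≤ T
2*≤-cancel {x} {y} {N} {T} xN≤yT 2y≤N = *-cancelʳ-≤ _ _ N (begin
  2 * x * N    ≡⟨ *-assoc 2 x N ⟩
  2 * (x * N)  ≤⟨ *-monoʳ-≤ 2 xN≤yT ⟩
  2 * (y * T)  ≡⟨ *-assoc 2 y T ⟨
  2 * y * T    ≤⟨ *-monoˡ-≤ T 2y≤N ⟩
  N * T        ≡⟨ *-comm N T ⟩
  T * N        ∎)
  where open ≤-Reasoning

-- Choice of parameters

-- R = 2(m + 1), so a side of size n / (m + 1) has 2s vertices; D = 4R², so D s² / n = 4n and
-- (1 - D/n)^(s²) ≤ e^(-4n) beats the 4^n pairs of sides.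
module Parameters (k m : ℕ) where

  -- Opaque: letting unification unfold these expressions makes type checking blow up.
  opaque
    R : ℕ
    R = 2 * suc m

    D : ℕ
    D = 4 * R * R

  K : ℕ
  K = ∑[ j ← upTo k ] ((2 * D) ^ (3 + j))

  opaque
    unfolding R D

    s : ℕ
    s = 4 * R * suc K

    n : ℕ
    n = R * s

    instance
      n-nonZero : NonZero n
      n-nonZero = _

    n≡D*[1+K] : n ≡ D * suc K
    n≡D*[1+K] = reassoc R (suc K)
      where
      reassoc : ∀ r t → r * (4 * r * t) ≡ 4 * r * r * t
      reassoc = solve-∀

    s*s≡[1+K]*[4*n] : s * s ≡ suc K * (4 * n)
    s*s≡[1+K]*[4*n] = reassoc R (suc K)
      where
      reassoc : ∀ r t → (4 * r * t) * (4 * r * t) ≡ t * (4 * (r * (4 * r * t)))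
      reassoc = solve-∀

    2*K≤s : 2 * K ≤ s
    2*K≤s = *-mono-≤ {2} {4 * R} (≤-trans (s≤s (s≤s z≤n)) (*-monoʳ-≤ 4 {1} {R} (s≤s z≤n))) (n≤1+n K)

    1≤s : 1 ≤ s
    1≤s = *-mono-≤ {1} {4 * R} (≤-trans (s≤s z≤n) (*-monoʳ-≤ 4 {1} {R} (s≤s z≤n))) (s≤s z≤n)

    2≤n : 2 ≤ n
    2≤n = *-mono-≤ {2} {R} (*-monoʳ-≤ 2 (s≤s z≤n)) 1≤s

    2*s≤ : ∀ {c} → n ≤ suc m * c → 2 * s ≤ c
    2*s≤ {c} n≤ = *-cancelˡ-≤ (suc m) (subst (_≤ suc m * c) (reassoc (suc m) s) n≤)
      where
      reassoc : ∀ a b → 2 * a * b ≡ a * (2 * b)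
      reassoc = solve-∀

  D≤n : D ≤ n
  D≤n = subst (D ≤_) (sym n≡D*[1+K]) (m≤m*n D (suc K))

  n∸D≡D*K : n ∸ D ≡ D * K
  n∸D≡D*K = trans (cong (_∸ D) (trans n≡D*[1+K] (*-suc D K))) (m+n∸m≡n D (D * K))

  2*4^n*[n∸D]^[s*s]≤n^[s*s] : 2 * (4 ^ n * (n ∸ D) ^ (s * s)) ≤ n ^ (s * s)
  2*4^n*[n∸D]^[s*s]≤n^[s*s] = subst₂ (λ x e → 2 * (4 ^ n * x ^ e) ≤ n ^ e) (sym n∸D≡D*K) (sym s*s≡[1+K]*[4*n])
    (subst (λ x → 2 * (4 ^ n * (D * K) ^ (suc K * (4 * n))) ≤ x ^ (suc K * (4 * n))) (sym n≡D*[1+K])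
      (2*4^n*[cK]^e≤[c[1+K]]^e D K n))

∃-shortCycleFree∧noLinearHomogeneousPair : ∀ k m → 1 < k →
  ∃ λ G → ShortCycleFree k G × 2 ≤ size G × NoLinearHomogeneousPair m G
∃-shortCycleFree∧noLinearHomogeneousPair k m 1<k =
  delete (first-moment (seeds n) (arcFreePairs D s) (orientedShortCycles D k) {s} {K} 0<T 2A≤T W≤KT 2*K≤s)
  where
  open Parameters k m
  delete : (∃ λ F → arcFreePairs D s F ≡ 0 × orientedShortCycles D k F ≤ s) →
           ∃ λ G → ShortCycleFree k G × 2 ≤ size G × NoLinearHomogeneousPair m G
  delete (F , noArcFreePair , fewShortCycles) = graph , graph-shortCycle-free , 2≤n ,
    noLinearHomogeneousPair m s 1<k 1≤s 2*s≤ noArcFreePair fewShortCycles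
    where open Deletion D k F
  0<T : 0 < length (seeds n)
  0<T = subst (0 <_) (sym (length-seeds n)) (m^n>0 (n ^ n) {{m^n≢0 n n}} n)
  2A≤T : 2 * ∑[ F ← seeds n ] arcFreePairs D s F ≤ length (seeds n)
  2A≤T = 2*≤-cancel {x = ∑[ F ← seeds n ] arcFreePairs D s F} {y = 4 ^ n * (n ∸ D) ^ (s * s)} {{m^n≢0 n (s * s)}}
           (∑-seeds-arcFreePairs n D s D≤n) 2*4^n*[n∸D]^[s*s]≤n^[s*s]
  W≤KT : ∑[ F ← seeds n ] orientedShortCycles D k F ≤ K * length (seeds n)
  W≤KT = ∑-seeds-orientedShortCycles n D k D≤n

adj⇒≢ : ∀ G {u v} → adj G u v ≡ true → u ≢ v
adj⇒≢ G {u} e refl = contradiction (trans (sym e) (irref G u)) λ ()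

adj-complement-true⇒ : ∀ G {u v} → adj (complement G) u v ≡ true → adj G u v ≡ false
adj-complement-true⇒ G {u} {v} e = not≡true⁻ (proj₁ (∧≡true⁻ {not (adj G u v)} e))

adj-complement-false⇒ : ∀ G {u v} → u ≢ v → adj (complement G) u v ≡ false → adj G u v ≡ true
adj-complement-false⇒ G {u} {v} u≢v e =
  trans (sym (not-involutive _)) (cong not (∧≡false⇒ˡ e (cong not (dec-false (u ≟ v) u≢v))))

Homogeneous-complement : ∀ G P Q → Homogeneous (complement G) P Q → Homogeneous G P Q
Homogeneous-complement G P Q (disjoint , inj₁ complete) =
  disjoint , inj₂ λ p q p∈P q∈Q → adj-complement-true⇒ G (complete p q p∈P q∈Q)
Homogeneous-complement G P Q (disjoint , inj₂ anticomplete) =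
  disjoint , inj₁ λ p q p∈P q∈Q →
    adj-complement-false⇒ G (λ { refl → disjoint p p∈P q∈Q }) (anticomplete p q p∈P q∈Q)

ShortCycleFree⇒Free : ∀ {k G} (ℋ : Family) → ShortCycleFree k G →
  (∀ H → ℋ H → HasCycleAtMost k H) → Free ℋ G
ShortCycleFree⇒Free {G = G} ℋ G-free short H H∈ℋ (f , f-inj , f-adj) with short H H∈ℋ
... | j , 3+j≤k , cyc = G-free j (≤-trans (s≤s (m≤n+m j 2)) 3+j≤k)
  (HasCycleOfLength3+-map {H} {G} f f-inj (λ x y e → trans (sym (f-adj x y)) e) cyc)

ShortCycleFree⇒Free-complement : ∀ {k G} (ℋ : Family) → ShortCycleFree k G →
  (∀ H → ℋ H → HasCycleAtMost k (complement H)) → Free ℋ (complement G)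
ShortCycleFree⇒Free-complement {G = G} ℋ G-free coshort H H∈ℋ (f , f-inj , f-adj) with coshort H H∈ℋ
... | j , 3+j≤k , cyc = G-free j (≤-trans (s≤s (m≤n+m j 2)) 3+j≤k)
  (HasCycleOfLength3+-map {complement H} {G} f f-inj edge-preserved cyc)
  where
  edge-preserved : ∀ x y → adj (complement H) x y ≡ true → adj G (f x) (f y) ≡ true
  edge-preserved x y e = adj-complement-false⇒ G (adj⇒≢ (complement H) e ∘ f-inj)
                           (trans (sym (f-adj x y)) (adj-complement-true⇒ H e))

lemma7p1 : (k : ℕ) → 2 < k → (ℋ : Family) →
    ((∀ H → ℋ H → HasCycleAtMost k H)
    ⊎ (∀ H → ℋ H → HasCycleAtMost k (complement H))) →
    ¬ StrongEH (Free ℋ)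
lemma7p1 k 2<k ℋ cycles (m , strongEH) =
  refute (∃-shortCycleFree∧noLinearHomogeneousPair k m (≤-trans (n≤1+n 2) 2<k)) cycles
  where
  refute : (∃ λ G → ShortCycleFree k G × 2 ≤ size G × NoLinearHomogeneousPair m G) →
           (∀ H → ℋ H → HasCycleAtMost k H) ⊎ (∀ H → ℋ H → HasCycleAtMost k (complement H)) → ⊥
  refute (G , G-free , 2≤G , noLinearPair) (inj₁ short) =
    let P , Q , hom , P-large , Q-large = strongEH G (ShortCycleFree⇒Free {G = G} ℋ G-free short) 2≤G
    in  noLinearPair P Q hom P-large Q-large
  refute (G , G-free , 2≤G , noLinearPair) (inj₂ coshort) =
    let P , Q , hom , P-large , Q-large = strongEH (complement G) (ShortCycleFree⇒Free-complement {G = G} ℋ G-free coshort) 2≤G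
    in  noLinearPair P Q (Homogeneous-complement G P Q hom) P-large Q-large
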